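{- For all integers $k\ge2$ and $i\ge1$, \[ \frac{(k+2i+1)(k+2i)(k-i)}{(3i+3)(3i+2)(3i+1)}\le\frac{k^3+k^2}{60}. \] -}

module Defs where

open import Data.Integer using (∣_∣; ℤ; +_; -[1+_]; _+_; _*_; _-_; _≤_; +≤+)
import Data.Nat as ℕ
open import Data.Rational using (ℚ; _/_; _÷_; NonZero)
import Data.Rational as ℚ
open import Data.Empty using (⊥-elim)
import Data.Integer


num : ℤ → ℤ → ℤ
num k i = ((k + + 2 * i + + 1) * (k + + 2 * i)) * (k - i)

den : ℤ → ℤ
den i = ((+ 3 * i + + 3) * (+ 3 * i + + 2)) * (+ 3 * i + + 1)

-- left-hand side  (k+2i+1)(k+2i)(k-i) / ((3i+3)(3i+2)(3i+1))  for i ≥ 1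
-- (the denominator is a positive integer, so it is taken as its absolute value
--  ∣ den i ∣ : ℕ, which is definitionally a successor when i ≥ 1)
lhs : (k i : ℤ) → + 1 ≤ i → ℚ
lhs k (+ ℕ.suc n) _ = num k (+ ℕ.suc n) / ∣ den (+ ℕ.suc n) ∣
lhs k (+ ℕ.zero) (+≤+ ())

rhs : ℤ → ℚ
rhs k = (k * k * k + k * k) / 60

-- Cross-multiplying, the claim is 60·num ≤ (k³ + k²)·den. If k ≤ i the numerator is ≤ 0 while
-- the right-hand side is ≥ 0. Otherwise write i = 1 + b and k = i + 1 + c with b, c ≥ 0: the
-- difference of the two sides is then a polynomial in b and c with nonnegative coefficients.
module Submission where

open import Defs
open import Data.Integer using (ℤ; +_; _≤_)
open import Data.Rational using () renaming (_≤_ to _≤ℚ_)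

open import Data.Integer using (0ℤ; +≤+; _+_; _*_; ∣_∣; nonNegative)
import Data.Integer.Properties as ℤ
open import Data.Integer.Solver using (module +-*-Solver)
open import Data.Nat as ℕ using (ℕ; zero; suc) hiding (module ℕ)
import Data.Nat.Properties as ℕ
open import Data.Product using (_,_)
open import Data.Rational using (_/_)
import Data.Rational.Properties as ℚ
open import Data.Rational.Unnormalised using (mkℚᵘ; *≤*)
import Data.Rational.Unnormalised.Properties as ℚᵘ
open import Data.Sum using (inj₁; inj₂)
open import Relation.Binary.PropositionalEquality using (_≡_; refl)

*≤*⇒/≤/ : ∀ p r {q s} .{{_ : ℕ.NonZero q}} .{{_ : ℕ.NonZero s}} → p * + s ≤ r * + q → p / q ≤ℚ r / s
*≤*⇒/≤/ p r {suc q} {suc s} ps≤rq = ℚ.toℚᵘ-cancel-≤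
  (ℚᵘ.≤-respˡ-≃ (ℚᵘ.≃-sym (ℚ.toℚᵘ-fromℚᵘ (mkℚᵘ p q)))
    (ℚᵘ.≤-respʳ-≃ (ℚᵘ.≃-sym (ℚ.toℚᵘ-fromℚᵘ (mkℚᵘ r s))) (*≤* ps≤rq)))

infixl 6 _⊕_
infixl 7 _⊗_

data Poly : Set where
  con     : ℕ → Poly
  X Y     : Poly
  _⊕_ _⊗_ : Poly → Poly → Poly

-- Folding into the ring solver's syntax lets the identity below mention gap without restating it.
evalWith : {A : Set} → (ℕ → A) → (A → A → A) → (A → A → A) → A → A → Poly → A
evalWith c _+′_ _*′_ x y (con n) = c n
evalWith c _+′_ _*′_ x y X       = x
evalWith c _+′_ _*′_ x y Y       = y
evalWith c _+′_ _*′_ x y (p ⊕ q) = evalWith c _+′_ _*′_ x y p +′ evalWith c _+′_ _*′_ x y q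
evalWith c _+′_ _*′_ x y (p ⊗ q) = evalWith c _+′_ _*′_ x y p *′ evalWith c _+′_ _*′_ x y q

⟦_⟧ : Poly → ℤ → ℤ → ℤ
⟦ p ⟧ x y = evalWith +_ _+_ _*_ x y p

⟦⟧-nonNeg : ∀ p m n → 0ℤ ≤ ⟦ p ⟧ (+ m) (+ n)
⟦⟧-nonNeg (con a) m n = +≤+ ℕ.z≤n
⟦⟧-nonNeg X       m n = +≤+ ℕ.z≤n
⟦⟧-nonNeg Y       m n = +≤+ ℕ.z≤n
⟦⟧-nonNeg (p ⊕ q) m n = ℤ.+-mono-≤ (⟦⟧-nonNeg p m n) (⟦⟧-nonNeg q m n)
⟦⟧-nonNeg (p ⊗ q) m n =
  ℤ.*-monoʳ-≤-nonNeg (⟦ q ⟧ (+ m) (+ n)) {{nonNegative (⟦⟧-nonNeg q m n)}} (⟦⟧-nonNeg p m n)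

-- (k³ + k²)·den i − 60·num k i at k = 2 + b + c and i = 1 + b, in Horner form in X = b, Y = c.
gap : Poly
gap = con 60 ⊗ (con 4 ⊕ Y ⊗ (con 3 ⊕ Y ⊗ (con 4 ⊕ Y)))
    ⊕ X ⊗ (con 6 ⊗ (con 494 ⊕ Y ⊗ (con 542 ⊕ Y ⊗ (con 259 ⊕ Y ⊗ con 37)))
    ⊕ X ⊗ (con 3 ⊗ (con 1824 ⊕ Y ⊗ (con 1696 ⊕ Y ⊗ (con 537 ⊕ Y ⊗ con 45)))
    ⊕ X ⊗ (con 9 ⊗ (con 462 ⊕ Y ⊗ (con 332 ⊕ Y ⊗ (con 66 ⊕ Y ⊗ con 3)))
    ⊕ X ⊗ (con 3 ⊗ (con 533 ⊕ Y ⊗ (con 261 ⊕ Y ⊗ con 27))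
    ⊕ X ⊗ (con 81 ⊗ (con 4 ⊕ Y)
    ⊕ X ⊗ con 27)))))

num*60+gap≡[k³+k²]*den : ∀ b c → let k = + 2 + b + c; i = + 1 + b in
  num k i * + 60 + ⟦ gap ⟧ b c ≡ (k * k * k + k * k) * den i
num*60+gap≡[k³+k²]*den = solve 2 (λ b c →
  let k = con (+ 2) :+ b :+ c
      i = con (+ 1) :+ b
  in  (k :+ con (+ 2) :* i :+ con (+ 1)) :* (k :+ con (+ 2) :* i) :* (k :- i) :* con (+ 60)
        :+ evalWith (λ n → con (+ n)) _:+_ _:*_ b c gap
      := (k :* k :* k :+ k :* k)
        :* ((con (+ 3) :* i :+ con (+ 3)) :* (con (+ 3) :* i :+ con (+ 2)) :* (con (+ 3) :* i :+ con (+ 1))))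
  refl
  where open +-*-Solver

-- ⟦ p ⟧ computes to the ℤ expression p spells out, so ⟦⟧-nonNeg applies to the factors of num and den.
num≤0 : ∀ {k i} → k ℕ.≤ i → num (+ k) (+ i) ≤ 0ℤ
num≤0 {k} {i} k≤i = begin
  num (+ k) (+ i)   ≤⟨ ℤ.*-monoˡ-≤-nonNeg f {{nonNegative (⟦⟧-nonNeg factor k i)}} (ℤ.i≤j⇒i-j≤0 (+≤+ k≤i)) ⟩
  f * 0ℤ            ≡⟨ ℤ.*-zeroʳ f ⟩
  0ℤ                ∎
  where
  open ℤ.≤-Reasoning
  factor : Poly
  factor = (X ⊕ con 2 ⊗ Y ⊕ con 1) ⊗ (X ⊕ con 2 ⊗ Y)
  f : ℤ
  f = ⟦ factor ⟧ (+ k) (+ i)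

num*60≤[k³+k²]*den : ∀ k b → num (+ k) (+ suc b) * + 60 ≤ (+ k * + k * + k + + k * + k) * den (+ suc b)
num*60≤[k³+k²]*den k b with ℕ.≤-<-connex k (suc b)
... | inj₁ k≤i = begin
  num (+ k) (+ suc b) * + 60     ≤⟨ ℤ.*-monoʳ-≤-nonNeg (+ 60) (num≤0 k≤i) ⟩
  0ℤ                             ≤⟨ ⟦⟧-nonNeg ((X ⊗ X ⊗ X ⊕ X ⊗ X) ⊗ denominator) k (suc b) ⟩
  (+ k * + k * + k + + k * + k) * den (+ suc b) ∎
  where
  open ℤ.≤-Reasoning
  denominator : Poly
  denominator = (con 3 ⊗ Y ⊕ con 3) ⊗ (con 3 ⊗ Y ⊕ con 2) ⊗ (con 3 ⊗ Y ⊕ con 1)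
... | inj₂ i<k with ℕ.m≤n⇒∃[o]m+o≡n i<k
...   | c , refl = begin
  num (+ k) (+ suc b) * + 60
    ≤⟨ ℤ.i≤i+j _ (⟦ gap ⟧ (+ b) (+ c)) {{nonNegative (⟦⟧-nonNeg gap b c)}} ⟩
  num (+ k) (+ suc b) * + 60 + ⟦ gap ⟧ (+ b) (+ c)
    ≡⟨ num*60+gap≡[k³+k²]*den (+ b) (+ c) ⟩
  (+ k * + k * + k + + k * + k) * den (+ suc b) ∎
  where open ℤ.≤-Reasoning

lemma3p8 : (k i : ℤ) → (hk : + 2 ≤ k) → (hi : + 1 ≤ i) → lhs k i hi ≤ℚ rhs k
lemma3p8 (+ k) (+ suc b) _ _ =
  *≤*⇒/≤/ (num (+ k) (+ suc b)) (+ k * + k * + k + + k * + k) {∣ den (+ suc b) ∣} {60}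
    (num*60≤[k³+k²]*den k b)
lemma3p8 (+ k) (+ zero) _ (+≤+ ())
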